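{- Let $U$ be a descendant chain. Any two descents of $U$ are equivalent modulo $f$-commutativity.
   Context: Words are over $\mathcal{A}_\square=\{\mathsf{R},\mathsf{L},\mathsf{U},\mathsf{D}\}$ with reversal $\mathsf{R}\leftrightarrow\mathsf{L}$, $\mathsf{U}\leftrightarrow\mathsf{D}$. The reverse of $w_1\cdots w_k$ is $w_k^{ -1}\cdots w_1^{ -1}$. A word chain is a cyclic sequence $U_1:\cdots:U_8$ of words, indices modulo $8$. Lifts. For $V=\varphi(U)$: - $f_i$, for $i=1,\dots,4$: $V_j=U_j$ for $j\not\equiv i\pmod 4$, and $V_j=(U_{j+3}U_{j+4}U_{j+5})^{ -1}$ for $j\equiv i\pmod 4$. - $g^\star_{\mathrm{odd}}$: $V_i=(U_{i-2}\cdots U_{i+2})^{ -1}$ for odd $i$, and $V_i=U_{i+3}U_{i+4}U_{i+5}$ for even $i$. - $g^\star_{\mathrm{even}}$: "odd" and "even" swapped. Descents. The Greek cross is $\mathsf{R}:\mathsf{U}\mathsf{R}:\mathsf{U}:\mathsf{L}\mathsf{U}:\mathsf{L}:\mathsf{D}\mathsf{L}:\mathsf{D}:\mathsf{R}\mathsf{D}$. A descent of a word chain $U$ is a finite sequence $(\varphi_1,\dots,\varphi_k)$ of elements of $\{f_1,f_2,f_3,f_4,g^\star_{\mathrm{odd}},g^\star_{\mathrm{even}}\}$ with $U=\varphi_k\circ\cdots\circ\varphi_1(\text{Greek cross})$. A descendant chain is a chain that has a descent. Two descents are equivalent modulo $f$-commutativity if one can be obtained from the other by repeatedly swapping adjacent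 entries $f_1,f_3$ or adjacent entries $f_2,f_4$. -}

module Defs where

open import Data.Nat using (ℕ; zero; suc; _+_; _%_)
open import Data.Nat.Properties using (_≟_)
open import Data.Fin using (Fin; zero; suc; toℕ; fromℕ<)
open import Data.Nat.DivMod using (m%n<n)
open import Data.List using (List; []; _∷_; _++_; reverse; map; foldl)
open import Data.Vec using (Vec; lookup; tabulate)
open import Data.Bool using (Bool; true; false; if_then_else_)
open import Relation.Nullary.Decidable using (⌊_⌋)
open import Relation.Binary.PropositionalEquality using (_≡_)
open import Relation.Binary.Construct.Closure.ReflexiveTransitive using (Star)
open import Data.Product using (∃)

data Letter : Set where
  R L U D : Letter

inv : Letter → Letter
inv R = L
inv L = R
inv U = D
inv D = U

Word : Set
Word = List Letter

_⁻¹ʷ : Word → Word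
w ⁻¹ʷ = reverse (map inv w)

-- A word chain U₁:⋯:U₈.  Position k : Fin 8 stores U_{toℕ k + 1};
-- indices are taken modulo 8.
Chain : Set
Chain = Vec Word 8

shift : Fin 8 → ℕ → Fin 8
shift k m = fromℕ< (m%n<n (toℕ k + m) 8)

at : Chain → Fin 8 → ℕ → Word
at C k m = lookup C (shift k m)

-- the paper's index i = toℕ k + 1 is odd  iff  toℕ k is even
indexOdd : Fin 8 → Bool
indexOdd k = ⌊ (toℕ k % 2) ≟ 0 ⌋

-- Lifts.  f a  (a : Fin 4) is the paper's f_{toℕ a + 1}.
data Lift : Set where
  f : Fin 4 → Lift
  gOdd gEven : Lift

fEntry : Chain → Fin 8 → Word
fEntry C k = (at C k 3 ++ at C k 4 ++ at C k 5) ⁻¹ʷ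

-- (U_{i-2} ⋯ U_{i+2})⁻¹ ; note i-2 ≡ i+6, i-1 ≡ i+7 (mod 8)
gInv : Chain → Fin 8 → Word
gInv C k = (at C k 6 ++ at C k 7 ++ at C k 0 ++ at C k 1 ++ at C k 2) ⁻¹ʷ

gFwd : Chain → Fin 8 → Word
gFwd C k = at C k 3 ++ at C k 4 ++ at C k 5

act : Lift → Chain → Chain
act (f a) C = tabulate λ k →
  if ⌊ (toℕ k % 4) ≟ toℕ a ⌋ then fEntry C k else lookup C k
act gOdd C = tabulate λ k →
  if indexOdd k then gInv C k else gFwd C k
act gEven C = tabulate λ k →
  if indexOdd k then gFwd C k else gInv C k

greekCross : Chain
greekCross =
  (R ∷ []) Data.Vec.∷ (U ∷ R ∷ []) Data.Vec.∷ (U ∷ []) Data.Vec.∷ (L ∷ U ∷ [])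
  Data.Vec.∷ (L ∷ []) Data.Vec.∷ (D ∷ L ∷ []) Data.Vec.∷ (D ∷ [])
  Data.Vec.∷ (R ∷ D ∷ []) Data.Vec.∷ Data.Vec.[]

-- a sequence (φ₁, …, φ_k) yields φ_k ∘ ⋯ ∘ φ₁ (Greek cross)
applyDescent : List Lift → Chain
applyDescent ds = foldl (λ C φ → act φ C) greekCross ds

IsDescent : List Lift → Chain → Set
IsDescent ds C = applyDescent ds ≡ C

IsDescendant : Chain → Set
IsDescendant C = ∃ λ ds → IsDescent ds C

data FCommute : Lift → Lift → Set where
  c13 : FCommute (f zero) (f (suc (suc zero)))
  c31 : FCommute (f (suc (suc zero))) (f zero)
  c24 : FCommute (f (suc zero)) (f (suc (suc (suc zero))))
  c42 : FCommute (f (suc (suc (suc zero)))) (f (suc zero))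

data SwapStep : List Lift → List Lift → Set where
  here  : ∀ {a b} (rest : List Lift) → FCommute a b →
          SwapStep (a ∷ b ∷ rest) (b ∷ a ∷ rest)
  there : ∀ {x xs ys} → SwapStep xs ys → SwapStep (x ∷ xs) (x ∷ ys)

_≈f_ : List Lift → List Lift → Set
_≈f_ = Star SwapStep

-- On word lengths every lift acts on ℕ⁸ by replacing some entries with sums of three or five
-- cyclically consecutive entries, and a descent becomes an orbit of the length vector
-- (1,2,1,2,1,2,1,2) of the Greek cross.  On vectors with positive entries these maps are
-- injective, and two different lifts have disjoint images unless they are f_i and f_{i+2}, whose
-- common images all come from a common square f_i ∘ f_{i+2} = f_{i+2} ∘ f_i.  The images are
-- told apart by inequalities between lengths: f_i makes |V_i| exceed |V_{i+3}| + |V_{i+5}|, which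
-- f_{i+1}, g*_odd and g*_even never do, and g*_odd makes |V_1| exceed |V_4|, which g*_even never
-- does.  Every lift also creates an entry of size at least 3, so the Greek cross is in no image.
-- Hence two descents of the same chain can be rearranged, modulo f-commutativity, to end with
-- the same lift, and induction on the descent gives the result.
module Submission where

open import Defs
open import Data.Bool using (Bool; true; false; if_then_else_)
open import Data.Empty using (⊥-elim)
open import Data.Fin using (Fin; zero; suc; toℕ; fromℕ<; _↑ˡ_; #_)
open import Data.List using (List; []; _∷_; _++_; [_]; length; reverse; foldr; foldl)
open import Data.List.Properties
  using (length-++; length-reverse; length-map; reverse-++; unfold-reverse; reverse-involutive;
         reverse-foldr)
open import Data.Nat using (ℕ; _+_; _%_; _≤_; _<_; _<?_; z<s)
open import Data.Nat.DivMod using (m%n<n)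
open import Data.Nat.Properties
  using (_≟_; ≤-trans; +-assoc; +-cancelˡ-≡; +-cancelʳ-≡; +-mono-≤; +-monoʳ-≤; +-monoʳ-<;
         m≤m+n; m≤n+m; m<m+n; m<n+m; ≤⇒≯; <⇒≱; module ≤-Reasoning)
open import Data.Product using (∃-syntax; _×_; _,_)
open import Data.Vec as Vec using (Vec; []; _∷_; lookup; tabulate)
open import Data.Vec.Properties using (lookup-map; tabulate-∘; tabulate-cong)
open import Data.Vec.Relation.Unary.All as All using (All; []; _∷_)
open import Data.Vec.Relation.Unary.All.Properties using (lookup⁺)
open import Data.Vec.Relation.Binary.Pointwise.Inductive
  using ([]; _∷_; Pointwise-≡⇒≡; ≡⇒Pointwise-≡)
open import Function using (flip)
open import Relation.Binary.PropositionalEquality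
  using (_≡_; _≢_; refl; sym; trans; cong; cong₂; subst; subst₂; module ≡-Reasoning)
open import Relation.Binary.Construct.Closure.ReflexiveTransitive using (ε; _◅_; _◅◅_; gmap)
open import Relation.Nullary using (¬_)
open import Relation.Nullary.Decidable using (⌊_⌋; from-yes)

pattern f₁ = f zero
pattern f₂ = f (suc zero)
pattern f₃ = f (suc (suc zero))
pattern f₄ = f (suc (suc (suc zero)))

m+o<m+[n+o] : ∀ m {n o} → 0 < n → m + o < m + (n + o)
m+o<m+[n+o] m {n} {o} n>0 = +-monoʳ-< m (m<n+m o n>0)

m≤n+[m+o] : ∀ {m} n {o} → m ≤ n + (m + o)
m≤n+[m+o] {m} n {o} = ≤-trans (m≤m+n m o) (m≤n+m (m + o) n)

m≤n+[o+m] : ∀ {m} n o → m ≤ n + (o + m)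
m≤n+[o+m] {m} n o = ≤-trans (m≤n+m m o) (m≤n+m (o + m) n)

m≤[n+[o+m]]+p : ∀ {m} n o {p} → m ≤ (n + (o + m)) + p
m≤[n+[o+m]]+p {m} n o {p} = ≤-trans (m≤n+[o+m] n o) (m≤m+n (n + (o + m)) p)

m+[n+[o+p]]≤[m+[n+o]]+[o+p] : ∀ m n o {p} → m + (n + (o + p)) ≤ (m + (n + o)) + (o + p)
m+[n+[o+p]]≤[m+[n+o]]+[o+p] m n o {p} = begin
  m + (n + (o + p))       ≡⟨ cong (m +_) (+-assoc n o p) ⟨
  m + ((n + o) + p)       ≡⟨ +-assoc m (n + o) p ⟨
  (m + (n + o)) + p       ≤⟨ +-monoʳ-≤ (m + (n + o)) (m≤n+m p o) ⟩
  (m + (n + o)) + (o + p) ∎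
  where open ≤-Reasoning

+-cancel-middle : ∀ m {n p o} → m + (n + o) ≡ m + (p + o) → n ≡ p
+-cancel-middle m {n} {p} {o} eq = +-cancelʳ-≡ o n p (+-cancelˡ-≡ m (n + o) (p + o) eq)

centre-cancel : ∀ a b a′ b′ {c c′ r r′} →
  a + (b + r) ≡ a′ + (b′ + r′) → r ≡ r′ → a + (b + c) ≡ a′ + (b′ + c′) → c ≡ c′
centre-cancel a b a′ b′ {c} {c′} {r} {r′} long right left = +-cancelˡ-≡ (a + b) c c′ (begin
  (a + b) + c    ≡⟨ +-assoc a b c ⟩
  a + (b + c)    ≡⟨ left ⟩
  a′ + (b′ + c′) ≡⟨ +-assoc a′ b′ c′ ⟨
  (a′ + b′) + c′ ≡⟨ cong (_+ c′) prefix ⟨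
  (a + b) + c′   ∎)
  where
  open ≡-Reasoning
  prefix : a + b ≡ a′ + b′
  prefix = +-cancelʳ-≡ r (a + b) (a′ + b′) (begin
    (a + b) + r    ≡⟨ +-assoc a b r ⟩
    a + (b + r)    ≡⟨ long ⟩
    a′ + (b′ + r′) ≡⟨ +-assoc a′ b′ r′ ⟨
    (a′ + b′) + r′ ≡⟨ cong ((a′ + b′) +_) right ⟨
    (a′ + b′) + r  ∎)

FCommute-sym : ∀ {a b} → FCommute a b → FCommute b a
FCommute-sym c13 = c31
FCommute-sym c31 = c13
FCommute-sym c24 = c42
FCommute-sym c42 = c24

SwapStep-++ˡ : ∀ zs {xs ys} → SwapStep xs ys → SwapStep (zs ++ xs) (zs ++ ys)
SwapStep-++ˡ []       s = s
SwapStep-++ˡ (z ∷ zs) s = there (SwapStep-++ˡ zs s)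

SwapStep-++ʳ : ∀ zs {xs ys} → SwapStep xs ys → SwapStep (xs ++ zs) (ys ++ zs)
SwapStep-++ʳ zs (here rest c) = here (rest ++ zs) c
SwapStep-++ʳ zs (there s)     = there (SwapStep-++ʳ zs s)

SwapStep-reverse : ∀ {xs ys} → SwapStep xs ys → SwapStep (reverse xs) (reverse ys)
SwapStep-reverse (here {a} {b} rest c) =
  subst₂ SwapStep (sym (reverse-++ (a ∷ b ∷ []) rest)) (sym (reverse-++ (b ∷ a ∷ []) rest))
    (SwapStep-++ˡ (reverse rest) (here [] (FCommute-sym c)))
SwapStep-reverse (there {x} {xs} {ys} s) =
  subst₂ SwapStep (sym (unfold-reverse x xs)) (sym (unfold-reverse x ys))
    (SwapStep-++ʳ [ x ] (SwapStep-reverse s))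

∷-≈f : ∀ x {xs ys} → xs ≈f ys → (x ∷ xs) ≈f (x ∷ ys)
∷-≈f x = gmap (x ∷_) there

reverse-≈f : ∀ {xs ys} → xs ≈f ys → reverse xs ≈f reverse ys
reverse-≈f = gmap reverse SwapStep-reverse

Lengths : Set
Lengths = Vec ℕ 8

lengths : Chain → Lengths
lengths = Vec.map length

opposite₃ centred₅ : Lengths → Fin 8 → ℕ
opposite₃ X k = lookup X (shift k 3) + (lookup X (shift k 4) + lookup X (shift k 5))
centred₅ X k = lookup X (shift k 6) + (lookup X (shift k 7) +
  (lookup X (shift k 0) + (lookup X (shift k 1) + lookup X (shift k 2))))

lengthAct : Lift → Lengths → Lengths
lengthAct (f a) X = tabulate λ k → if ⌊ (toℕ k % 4) ≟ toℕ a ⌋ then opposite₃ X k else lookup X k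
lengthAct gOdd  X = tabulate λ k → if indexOdd k then centred₅ X k else opposite₃ X k
lengthAct gEven X = tabulate λ k → if indexOdd k then opposite₃ X k else centred₅ X k

length-⁻¹ʷ : ∀ w → length (w ⁻¹ʷ) ≡ length w
length-⁻¹ʷ w = trans (length-reverse (Data.List.map inv w)) (length-map inv w)

length-++₃ : ∀ (u v w : Word) → length (u ++ v ++ w) ≡ length u + (length v + length w)
length-++₃ u v w = trans (length-++ u) (cong (length u +_) (length-++ v))

length-lookup : ∀ C k → length (lookup C k) ≡ lookup (lengths C) k
length-lookup C k = sym (lookup-map k length C)

length-at₃ : ∀ C k l m n →
  length (at C k l ++ at C k m ++ at C k n) ≡
  lookup (lengths C) (shift k l) + (lookup (lengths C) (shift k m) + lookup (lengths C) (shift k n))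
length-at₃ C k l m n = trans (length-++₃ (at C k l) (at C k m) (at C k n))
  (cong₂ _+_ (length-lookup C _) (cong₂ _+_ (length-lookup C _) (length-lookup C _)))

length-gFwd : ∀ C k → length (gFwd C k) ≡ opposite₃ (lengths C) k
length-gFwd C k = length-at₃ C k 3 4 5

length-fEntry : ∀ C k → length (fEntry C k) ≡ opposite₃ (lengths C) k
length-fEntry C k = trans (length-⁻¹ʷ (gFwd C k)) (length-gFwd C k)

length-gInv : ∀ C k → length (gInv C k) ≡ centred₅ (lengths C) k
length-gInv C k = trans (length-⁻¹ʷ (at C k 6 ++ at C k 7 ++ block))
  (trans (length-++₃ (at C k 6) (at C k 7) block)
    (cong₂ _+_ (length-lookup C _) (cong₂ _+_ (length-lookup C _) (length-at₃ C k 0 1 2))))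
  where block = at C k 0 ++ at C k 1 ++ at C k 2

lengths-tabulate-if : ∀ (b : Fin 8 → Bool) (u v : Fin 8 → Word) {m n : Fin 8 → ℕ} →
  (∀ k → length (u k) ≡ m k) → (∀ k → length (v k) ≡ n k) →
  lengths (tabulate λ k → if b k then u k else v k) ≡ tabulate λ k → if b k then m k else n k
lengths-tabulate-if b u v {m} {n} eu ev =
  trans (sym (tabulate-∘ length λ k → if b k then u k else v k)) (tabulate-cong length-if)
  where
  length-if : ∀ k → length (if b k then u k else v k) ≡ (if b k then m k else n k)
  length-if k with b k
  ... | true  = eu k
  ... | false = ev k

lengths-act : ∀ φ C → lengths (act φ C) ≡ lengthAct φ (lengths C)
lengths-act (f a) C = lengths-tabulate-if (λ k → ⌊ (toℕ k % 4) ≟ toℕ a ⌋) (fEntry C) (lookup C)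
  (length-fEntry C) (length-lookup C)
lengths-act gOdd  C = lengths-tabulate-if indexOdd (gInv C) (gFwd C) (length-gInv C) (length-gFwd C)
lengths-act gEven C = lengths-tabulate-if indexOdd (gFwd C) (gInv C) (length-gFwd C) (length-gInv C)

-- The head of the list is the lift applied last.
descentLengths : List Lift → Lengths
descentLengths = foldr lengthAct (lengths greekCross)

lengths-foldl : ∀ C ds → lengths (foldl (flip act) C ds) ≡ foldl (flip lengthAct) (lengths C) ds
lengths-foldl C []       = refl
lengths-foldl C (φ ∷ ds) =
  trans (lengths-foldl (act φ C) ds) (cong (λ X → foldl (flip lengthAct) X ds) (lengths-act φ C))

lengths-applyDescent : ∀ ds → lengths (applyDescent ds) ≡ descentLengths (reverse ds)
lengths-applyDescent ds = trans (lengths-foldl greekCross ds) (sym (reverse-foldr lengthAct _ ds))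

Positive : Lengths → Set
Positive = All (0 <_)

pattern positive = z<s ∷ z<s ∷ z<s ∷ z<s ∷ z<s ∷ z<s ∷ z<s ∷ z<s ∷ []

lengthAct-positive : ∀ φ {X} → Positive X → Positive (lengthAct φ X)
lengthAct-positive f₁    positive = positive
lengthAct-positive f₂    positive = positive
lengthAct-positive f₃    positive = positive
lengthAct-positive f₄    positive = positive
lengthAct-positive gOdd  positive = positive
lengthAct-positive gEven positive = positive

descentLengths-positive : ∀ rs → Positive (descentLengths rs)
descentLengths-positive []       = positive
descentLengths-positive (φ ∷ rs) = lengthAct-positive φ (descentLengths-positive rs)

opposite₃-≥3 : ∀ {X} → Positive X → ∀ k → 3 ≤ opposite₃ X k
opposite₃-≥3 px k =
  +-mono-≤ (lookup⁺ px (shift k 3)) (+-mono-≤ (lookup⁺ px (shift k 4)) (lookup⁺ px (shift k 5)))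

lengthAct-has-long-entry : ∀ φ {X} → Positive X → ∃[ k ] 3 ≤ lookup (lengthAct φ X) k
lengthAct-has-long-entry f₁    px = # 0 , opposite₃-≥3 px (# 0)
lengthAct-has-long-entry f₂    px = # 1 , opposite₃-≥3 px (# 1)
lengthAct-has-long-entry f₃    px = # 2 , opposite₃-≥3 px (# 2)
lengthAct-has-long-entry f₄    px = # 3 , opposite₃-≥3 px (# 3)
lengthAct-has-long-entry gOdd  px = # 1 , opposite₃-≥3 px (# 1)
lengthAct-has-long-entry gEven px = # 0 , opposite₃-≥3 px (# 0)

greekCross-short : ∀ k → lookup (lengths greekCross) k < 3
greekCross-short = lookup⁺ (from-yes (All.all? (_<? 3) (lengths greekCross)))

greekCross-unlifted : ∀ φ {Z} → Positive Z → lengthAct φ Z ≢ lengths greekCross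
greekCross-unlifted φ pz eq with lengthAct-has-long-entry φ pz
... | k , long = <⇒≱ (greekCross-short k) (subst (λ Y → 3 ≤ lookup Y k) eq long)

lengthAct-injective : ∀ φ {X Z} → lengthAct φ X ≡ lengthAct φ Z → X ≡ Z
lengthAct-injective f₁ {_ ∷ _ ∷ _ ∷ x₃ ∷ _ ∷ _ ∷ _ ∷ x₇ ∷ []} {_ ∷ _ ∷ _ ∷ _ ∷ _ ∷ _ ∷ _ ∷ _ ∷ []} eq
  with e₀ ∷ refl ∷ refl ∷ refl ∷ e₄ ∷ refl ∷ refl ∷ refl ∷ [] ← ≡⇒Pointwise-≡ eq = Pointwise-≡⇒≡
  (+-cancel-middle x₇ e₄ ∷ refl ∷ refl ∷ refl ∷ +-cancel-middle x₃ e₀ ∷ refl ∷ refl ∷ refl ∷ [])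
lengthAct-injective f₂ {x₀ ∷ _ ∷ _ ∷ _ ∷ x₄ ∷ _ ∷ _ ∷ _ ∷ []} {_ ∷ _ ∷ _ ∷ _ ∷ _ ∷ _ ∷ _ ∷ _ ∷ []} eq
  with refl ∷ e₁ ∷ refl ∷ refl ∷ refl ∷ e₅ ∷ refl ∷ refl ∷ [] ← ≡⇒Pointwise-≡ eq = Pointwise-≡⇒≡
  (refl ∷ +-cancel-middle x₀ e₅ ∷ refl ∷ refl ∷ refl ∷ +-cancel-middle x₄ e₁ ∷ refl ∷ refl ∷ [])
lengthAct-injective f₃ {_ ∷ x₁ ∷ _ ∷ _ ∷ _ ∷ x₅ ∷ _ ∷ _ ∷ []} {_ ∷ _ ∷ _ ∷ _ ∷ _ ∷ _ ∷ _ ∷ _ ∷ []} eq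
  with refl ∷ refl ∷ e₂ ∷ refl ∷ refl ∷ refl ∷ e₆ ∷ refl ∷ [] ← ≡⇒Pointwise-≡ eq = Pointwise-≡⇒≡
  (refl ∷ refl ∷ +-cancel-middle x₁ e₆ ∷ refl ∷ refl ∷ refl ∷ +-cancel-middle x₅ e₂ ∷ refl ∷ [])
lengthAct-injective f₄ {_ ∷ _ ∷ x₂ ∷ _ ∷ _ ∷ _ ∷ x₆ ∷ _ ∷ []} {_ ∷ _ ∷ _ ∷ _ ∷ _ ∷ _ ∷ _ ∷ _ ∷ []} eq
  with refl ∷ refl ∷ refl ∷ e₃ ∷ refl ∷ refl ∷ refl ∷ e₇ ∷ [] ← ≡⇒Pointwise-≡ eq = Pointwise-≡⇒≡
  (refl ∷ refl ∷ refl ∷ +-cancel-middle x₂ e₇ ∷ refl ∷ refl ∷ refl ∷ +-cancel-middle x₆ e₃ ∷ [])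
-- Each five-term entry is flanked by the two three-term entries sharing its centre, which
-- pins down the centre; the remaining coordinates are middles of three-term entries.
lengthAct-injective gOdd
  {x₀ ∷ x₁ ∷ x₂ ∷ x₃ ∷ x₄ ∷ x₅ ∷ x₆ ∷ x₇ ∷ []} {z₀ ∷ z₁ ∷ z₂ ∷ z₃ ∷ z₄ ∷ z₅ ∷ z₆ ∷ z₇ ∷ []} eq
  with e₀ ∷ e₁ ∷ e₂ ∷ e₃ ∷ e₄ ∷ e₅ ∷ e₆ ∷ e₇ ∷ [] ← ≡⇒Pointwise-≡ eq
  with centre-cancel x₆ x₇ z₆ z₇ e₀ e₅ e₃ | centre-cancel x₀ x₁ z₀ z₁ e₂ e₇ e₅
     | centre-cancel x₂ x₃ z₂ z₃ e₄ e₁ e₇ | centre-cancel x₄ x₅ z₄ z₅ e₆ e₃ e₁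
... | refl | refl | refl | refl = Pointwise-≡⇒≡
  (refl ∷ +-cancel-middle x₀ e₅ ∷ refl ∷ +-cancel-middle x₂ e₇ ∷
   refl ∷ +-cancel-middle x₄ e₁ ∷ refl ∷ +-cancel-middle x₆ e₃ ∷ [])
lengthAct-injective gEven
  {x₀ ∷ x₁ ∷ x₂ ∷ x₃ ∷ x₄ ∷ x₅ ∷ x₆ ∷ x₇ ∷ []} {z₀ ∷ z₁ ∷ z₂ ∷ z₃ ∷ z₄ ∷ z₅ ∷ z₆ ∷ z₇ ∷ []} eq
  with e₀ ∷ e₁ ∷ e₂ ∷ e₃ ∷ e₄ ∷ e₅ ∷ e₆ ∷ e₇ ∷ [] ← ≡⇒Pointwise-≡ eq
  with centre-cancel x₇ x₀ z₇ z₀ e₁ e₆ e₄ | centre-cancel x₁ x₂ z₁ z₂ e₃ e₀ e₆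
     | centre-cancel x₃ x₄ z₃ z₄ e₅ e₂ e₀ | centre-cancel x₅ x₆ z₅ z₆ e₇ e₄ e₂
... | refl | refl | refl | refl = Pointwise-≡⇒≡
  (+-cancel-middle x₇ e₄ ∷ refl ∷ +-cancel-middle x₁ e₆ ∷ refl ∷
   +-cancel-middle x₃ e₀ ∷ refl ∷ +-cancel-middle x₅ e₂ ∷ refl ∷ [])

Square : Lift → Lift → Set
Square φ ψ = ∀ {X Z} → Positive X → Positive Z → lengthAct φ X ≡ lengthAct ψ Z →
  ∃[ W ] Positive W × X ≡ lengthAct ψ W × Z ≡ lengthAct φ W

square-sym : ∀ {φ ψ} → Square φ ψ → Square ψ φ
square-sym sq px pz eq with sq pz px (sym eq)
... | W , pw , Z≡φW , X≡ψW = W , pw , X≡ψW , Z≡φW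

f₁-f₃-square : Square f₁ f₃
f₁-f₃-square
  {x₀ ∷ x₁ ∷ _ ∷ x₃ ∷ x₄ ∷ x₅ ∷ _ ∷ x₇ ∷ []} {_ ∷ _ ∷ z₂ ∷ _ ∷ _ ∷ _ ∷ z₆ ∷ _ ∷ []}
  (p₀ ∷ p₁ ∷ _ ∷ p₃ ∷ p₄ ∷ p₅ ∷ _ ∷ p₇ ∷ []) (_ ∷ _ ∷ q₂ ∷ _ ∷ _ ∷ _ ∷ q₆ ∷ _ ∷ []) eq
  with refl ∷ refl ∷ refl ∷ refl ∷ refl ∷ refl ∷ refl ∷ refl ∷ [] ← ≡⇒Pointwise-≡ eq =
  x₀ ∷ x₁ ∷ z₂ ∷ x₃ ∷ x₄ ∷ x₅ ∷ z₆ ∷ x₇ ∷ [] ,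
  p₀ ∷ p₁ ∷ q₂ ∷ p₃ ∷ p₄ ∷ p₅ ∷ q₆ ∷ p₇ ∷ [] , refl , refl

f₂-f₄-square : Square f₂ f₄
f₂-f₄-square
  {x₀ ∷ x₁ ∷ x₂ ∷ _ ∷ x₄ ∷ x₅ ∷ x₆ ∷ _ ∷ []} {_ ∷ _ ∷ _ ∷ z₃ ∷ _ ∷ _ ∷ _ ∷ z₇ ∷ []}
  (p₀ ∷ p₁ ∷ p₂ ∷ _ ∷ p₄ ∷ p₅ ∷ p₆ ∷ _ ∷ []) (_ ∷ _ ∷ _ ∷ q₃ ∷ _ ∷ _ ∷ _ ∷ q₇ ∷ []) eq
  with refl ∷ refl ∷ refl ∷ refl ∷ refl ∷ refl ∷ refl ∷ refl ∷ [] ← ≡⇒Pointwise-≡ eq =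
  x₀ ∷ x₁ ∷ x₂ ∷ z₃ ∷ x₄ ∷ x₅ ∷ x₆ ∷ z₇ ∷ [] ,
  p₀ ∷ p₁ ∷ p₂ ∷ q₃ ∷ p₄ ∷ p₅ ∷ p₆ ∷ q₇ ∷ [] , refl , refl

commuting-square : ∀ {φ ψ} → FCommute φ ψ → Square φ ψ
commuting-square c13 = f₁-f₃-square
commuting-square c24 = f₂-f₄-square
commuting-square c31 = square-sym {f₁} {f₃} f₁-f₃-square
commuting-square c42 = square-sym {f₂} {f₄} f₂-f₄-square

Disjoint : Lift → Lift → Set
Disjoint φ ψ = ∀ {X Z} → Positive X → Positive Z → lengthAct φ X ≢ lengthAct ψ Z

Overlong : Fin 8 → Lengths → Set
Overlong k Y = lookup Y (shift k 3) + lookup Y (shift k 5) < lookup Y k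

f-overlong : ∀ a {X} → Positive X → Overlong (a ↑ˡ 4) (lengthAct (f a) X)
f-overlong zero                   {X} px = m+o<m+[n+o] (lookup X (# 3)) (lookup⁺ px (# 4))
f-overlong (suc zero)             {X} px = m+o<m+[n+o] (lookup X (# 4)) (lookup⁺ px (# 5))
f-overlong (suc (suc zero))       {X} px = m+o<m+[n+o] (lookup X (# 5)) (lookup⁺ px (# 6))
f-overlong (suc (suc (suc zero))) {X} px = m+o<m+[n+o] (lookup X (# 6)) (lookup⁺ px (# 7))

overlong-disjoint : ∀ a ψ → (∀ Z → ¬ Overlong (a ↑ˡ 4) (lengthAct ψ Z)) → Disjoint (f a) ψ
overlong-disjoint a _ not-overlong px _ eq =
  not-overlong _ (subst (Overlong (a ↑ˡ 4)) eq (f-overlong a px))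

next : Fin 4 → Fin 4
next a = fromℕ< (m%n<n (toℕ a + 1) 4)

f-next-not-overlong : ∀ a X → ¬ Overlong (a ↑ˡ 4) (lengthAct (f (next a)) X)
f-next-not-overlong zero                   (_ ∷ _ ∷ _ ∷ x₃ ∷ _)         = ≤⇒≯ (m≤n+[m+o] x₃)
f-next-not-overlong (suc zero)             (_ ∷ _ ∷ _ ∷ _ ∷ x₄ ∷ _)     = ≤⇒≯ (m≤n+[m+o] x₄)
f-next-not-overlong (suc (suc zero))       (_ ∷ _ ∷ _ ∷ _ ∷ _ ∷ x₅ ∷ _) = ≤⇒≯ (m≤n+[m+o] x₅)
f-next-not-overlong (suc (suc (suc zero))) (_ ∷ _ ∷ _ ∷ _ ∷ _ ∷ _ ∷ x₆ ∷ _) = ≤⇒≯ (m≤n+[m+o] x₆)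

gOdd-not-overlong : ∀ (a : Fin 4) X → ¬ Overlong (a ↑ˡ 4) (lengthAct gOdd X)
gOdd-not-overlong zero (x₀ ∷ _ ∷ _ ∷ _ ∷ _ ∷ _ ∷ x₆ ∷ x₇ ∷ []) =
  ≤⇒≯ (m+[n+[o+p]]≤[m+[n+o]]+[o+p] x₆ x₇ x₀)
gOdd-not-overlong (suc zero) (_ ∷ _ ∷ x₂ ∷ x₃ ∷ _ ∷ _ ∷ _ ∷ _ ∷ []) =
  ≤⇒≯ (m≤[n+[o+m]]+p x₂ x₃)
gOdd-not-overlong (suc (suc zero)) (x₀ ∷ x₁ ∷ x₂ ∷ _ ∷ _ ∷ _ ∷ _ ∷ _ ∷ []) =
  ≤⇒≯ (m+[n+[o+p]]≤[m+[n+o]]+[o+p] x₀ x₁ x₂)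
gOdd-not-overlong (suc (suc (suc zero))) (_ ∷ _ ∷ _ ∷ _ ∷ x₄ ∷ x₅ ∷ _ ∷ _ ∷ []) =
  ≤⇒≯ (m≤[n+[o+m]]+p x₄ x₅)

gEven-not-overlong : ∀ (a : Fin 4) X → ¬ Overlong (a ↑ˡ 4) (lengthAct gEven X)
gEven-not-overlong zero (_ ∷ x₁ ∷ x₂ ∷ _ ∷ _ ∷ _ ∷ _ ∷ _ ∷ []) =
  ≤⇒≯ (m≤[n+[o+m]]+p x₁ x₂)
gEven-not-overlong (suc zero) (x₀ ∷ x₁ ∷ _ ∷ _ ∷ _ ∷ _ ∷ _ ∷ x₇ ∷ []) =
  ≤⇒≯ (m+[n+[o+p]]≤[m+[n+o]]+[o+p] x₇ x₀ x₁)
gEven-not-overlong (suc (suc zero)) (_ ∷ _ ∷ _ ∷ x₃ ∷ x₄ ∷ _ ∷ _ ∷ _ ∷ []) =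
  ≤⇒≯ (m≤[n+[o+m]]+p x₃ x₄)
gEven-not-overlong (suc (suc (suc zero))) (_ ∷ x₁ ∷ x₂ ∷ x₃ ∷ _ ∷ _ ∷ _ ∷ _ ∷ []) =
  ≤⇒≯ (m+[n+[o+p]]≤[m+[n+o]]+[o+p] x₁ x₂ x₃)

f-next-disjoint : ∀ a → Disjoint (f a) (f (next a))
f-next-disjoint a = overlong-disjoint a (f (next a)) (f-next-not-overlong a)

f-gOdd-disjoint : ∀ a → Disjoint (f a) gOdd
f-gOdd-disjoint a = overlong-disjoint a gOdd (gOdd-not-overlong a)

f-gEven-disjoint : ∀ a → Disjoint (f a) gEven
f-gEven-disjoint a = overlong-disjoint a gEven (gEven-not-overlong a)

gOdd-gEven-disjoint : Disjoint gOdd gEven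
gOdd-gEven-disjoint {X} {Z} px _ eq =
  ≤⇒≯ shorter (subst (λ Y → lookup Y (# 3) < lookup Y (# 0)) eq longer)
  where
  longer : lookup (lengthAct gOdd X) (# 3) < lookup (lengthAct gOdd X) (# 0)
  longer = +-monoʳ-< (lookup X (# 6)) (+-monoʳ-< (lookup X (# 7))
             (m<m+n (lookup X (# 0)) (≤-trans (lookup⁺ px (# 1)) (m≤m+n _ _))))
  shorter : lookup (lengthAct gEven Z) (# 0) ≤ lookup (lengthAct gEven Z) (# 3)
  shorter = m≤n+[o+m] (lookup Z (# 1)) (lookup Z (# 2))

data Interaction : Lift → Lift → Set where
  same      : ∀ {φ} → Interaction φ φ
  commuting : ∀ {φ ψ} → FCommute φ ψ → Interaction φ ψ
  disjoint  : ∀ {φ ψ} → Disjoint φ ψ → Interaction φ ψ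

disjoint˘ : ∀ {φ ψ} → Disjoint ψ φ → Interaction φ ψ
disjoint˘ d = disjoint λ px pz eq → d pz px (sym eq)

interaction : ∀ φ ψ → Interaction φ ψ
interaction f₁ f₁ = same
interaction f₁ f₂ = disjoint  (f-next-disjoint (# 0))
interaction f₁ f₃ = commuting c13
interaction f₁ f₄ = disjoint˘ (f-next-disjoint (# 3))
interaction f₂ f₁ = disjoint˘ (f-next-disjoint (# 0))
interaction f₂ f₂ = same
interaction f₂ f₃ = disjoint  (f-next-disjoint (# 1))
interaction f₂ f₄ = commuting c24
interaction f₃ f₁ = commuting c31
interaction f₃ f₂ = disjoint˘ (f-next-disjoint (# 1))
interaction f₃ f₃ = same
interaction f₃ f₄ = disjoint  (f-next-disjoint (# 2))
interaction f₄ f₁ = disjoint  (f-next-disjoint (# 3))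
interaction f₄ f₂ = commuting c42
interaction f₄ f₃ = disjoint˘ (f-next-disjoint (# 2))
interaction f₄ f₄ = same
interaction (f a) gOdd  = disjoint  (f-gOdd-disjoint a)
interaction (f a) gEven = disjoint  (f-gEven-disjoint a)
interaction gOdd  (f a) = disjoint˘ (f-gOdd-disjoint a)
interaction gEven (f a) = disjoint˘ (f-gEven-disjoint a)
interaction gOdd  gOdd  = same
interaction gOdd  gEven = disjoint  gOdd-gEven-disjoint
interaction gEven gOdd  = disjoint˘ gOdd-gEven-disjoint
interaction gEven gEven = same

pull-to-front : ∀ rs ψ {Z} → Positive Z → descentLengths rs ≡ lengthAct ψ Z →
  ∃[ ts ] rs ≈f (ψ ∷ ts) × descentLengths ts ≡ Z
pull-to-front []       ψ pz eq = ⊥-elim (greekCross-unlifted ψ pz (sym eq))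
pull-to-front (φ ∷ rs) ψ pz eq with interaction φ ψ
... | same        = rs , ε , lengthAct-injective φ eq
... | disjoint d  = ⊥-elim (d (descentLengths-positive rs) pz eq)
... | commuting c with commuting-square c (descentLengths-positive rs) pz eq
...   | W , pw , rs↦ψW , Z≡φW with pull-to-front rs ψ pw rs↦ψW
...     | ts , rs≈ψts , ts↦W =
  φ ∷ ts , ∷-≈f φ rs≈ψts ◅◅ here ts c ◅ ε , trans (cong (lengthAct φ) ts↦W) (sym Z≡φW)

descentLengths-≡⇒≈f : ∀ rs ss → descentLengths rs ≡ descentLengths ss → rs ≈f ss
descentLengths-≡⇒≈f []       []       _  = ε
descentLengths-≡⇒≈f (φ ∷ rs) []       eq =
  ⊥-elim (greekCross-unlifted φ (descentLengths-positive rs) eq)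
descentLengths-≡⇒≈f rs       (ψ ∷ ss) eq with pull-to-front rs ψ (descentLengths-positive ss) eq
... | ts , rs≈ψts , ts↦ss = rs≈ψts ◅◅ ∷-≈f ψ (descentLengths-≡⇒≈f ts ss ts↦ss)

proposition1 : (C : Chain) → IsDescendant C →
    (ds es : List Lift) → IsDescent ds C → IsDescent es C → ds ≈f es
proposition1 C _ ds es ds↦C es↦C =
  subst₂ _≈f_ (reverse-involutive ds) (reverse-involutive es)
    (reverse-≈f (descentLengths-≡⇒≈f (reverse ds) (reverse es) same-lengths))
  where
  same-lengths : descentLengths (reverse ds) ≡ descentLengths (reverse es)
  same-lengths = trans (sym (lengths-applyDescent ds))
    (trans (cong lengths (trans ds↦C (sym es↦C))) (lengths-applyDescent es))
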